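{- The formula $\forall x\,\exists g\,\mathrm{Reif}(g,x)$ is derivable in $\mathrm{Z}_{st}$.
   Context: $\mathrm{Z}_{st}$ is intuitionistic Zermelo set theory with Strong Extensionality and Transitive Closure: equality axioms ($=$ reflexive, $x=x'\land x=y\Rightarrow x'=y$, $=$ compatible with $\in$ on both sides), the Strong Extensionality scheme $\forall a\forall b(R(a,b)\land\forall x\forall x'\forall y(x'\in x\land R(x,y)\Rightarrow\exists y'(y'\in y\land R(x',y')))\land\forall y\forall y'\forall x(y'\in y\land R(x,y)\Rightarrow\exists x'(x'\in x\land R(x',y')))\Rightarrow a=b)$ for every formula $R$ with parameters, Pairing, Union, Powerset, Restricted Comprehension, Infinity, and Transitive Closure $\forall a\exists e(a\subseteq e\land\forall x\forall y(x\in y\land y\in e\Rightarrow x\in e))$. Set-theoretic notations below are used as definitional abbreviations. Notation: $\langle a,b\rangle=\{\{a\},\{a,b\}\}$. A graph is a set all of whose elements are ordered pairs; $\mathrm{Car}(A)=\{x\in\bigcup\bigcup A\mid\exists y\,(\langle x,y\rangle\in A\lor\langle y,x\rangle\in A)\}$. A function $\phi$ is a set of ordered pairs with $\langle x,y\rangle,\langle x,y'\rangle\in\phi\Rightarrow y=y'$; $\mathrm{Dom}(\phi)$, $\mathrm{Cod}(\phi)$ are its sets of first and second components; $\phi(i)$ is the $y$ with $\langle i,y\rangle\in\phi$. $\mathrm{Collapse}(A,\phi)$ means: $A$ is a graph, $\phi$ is a function, $\mathrm{Dom}(\phi)=\mathrm{Car}(A)$, and for every $i\in\mathrm{Dom}(\phi)$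 and every $x$: $x\in\phi(i)$ iff there is $j\in\mathrm{Dom}(\phi)$ with $\langle j,i\rangle\in A$ and $x=\phi(j)$. $\hat\phi_A(i)=\{y\in\mathrm{Cod}(\phi)\mid\exists j\,(\langle j,i\rangle\in A\land\langle j,y\rangle\in\phi)\}$. $\mathrm{Reif}(g,x)\equiv\exists A\exists a\exists\phi\,(g=\langle A,a\rangle\land\mathrm{Collapse}(A,\phi)\land x=\hat\phi_A(a))$. -}

module Defs where

open import Data.Nat using (ℕ; zero; suc; _+_; _∸_)
open import Data.List using (List; _∷_; map)
open import Data.List.Membership.Propositional using (_∈_)

-- Formulas (de Bruijn indices; the only terms are variables)

infixr 6 _∧'_
infixr 5 _∨'_
infixr 4 _⇒'_

data Fm : Set where
  _∈'_ : ℕ → ℕ → Fm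
  _≐'_ : ℕ → ℕ → Fm
  ⊥'   : Fm
  _∧'_ : Fm → Fm → Fm
  _∨'_ : Fm → Fm → Fm
  _⇒'_ : Fm → Fm → Fm
  ∀'   : Fm → Fm
  ∃'   : Fm → Fm

lift : (ℕ → ℕ) → ℕ → ℕ
lift ρ zero    = zero
lift ρ (suc n) = suc (ρ n)

rename : (ℕ → ℕ) → Fm → Fm
rename ρ (x ∈' y) = ρ x ∈' ρ y
rename ρ (x ≐' y) = ρ x ≐' ρ y
rename ρ ⊥'       = ⊥'
rename ρ (φ ∧' ψ) = rename ρ φ ∧' rename ρ ψ
rename ρ (φ ∨' ψ) = rename ρ φ ∨' rename ρ ψ
rename ρ (φ ⇒' ψ) = rename ρ φ ⇒' rename ρ ψ
rename ρ (∀' φ)   = ∀' (rename (lift ρ) φ)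
rename ρ (∃' φ)   = ∃' (rename (lift ρ) φ)

wk : Fm → Fm
wk = rename suc

inst : ℕ → ℕ → ℕ
inst y zero    = y
inst y (suc n) = n

_[_] : Fm → ℕ → Fm
φ [ y ] = rename (inst y) φ

-- Named-variable notation for writing concrete formulas.
-- A "term" T is a formula depending on the current binder depth;
-- variables are referred to by de Bruijn *levels* (the binder
-- functions below supply them), converted to indices on the fly.

T : Set
T = ℕ → Fm

infix  8 _∈̂_ _≐̂_
infixr 6 _∧̂_
infixr 5 _∨̂_
infixr 4 _⇒̂_ _⇔̂_

_∈̂_ : ℕ → ℕ → T
(x ∈̂ y) d = (d ∸ suc x) ∈' (d ∸ suc y)

_≐̂_ : ℕ → ℕ → T
(x ≐̂ y) d = (d ∸ suc x) ≐' (d ∸ suc y)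

⊥̂ : T
⊥̂ d = ⊥'

_∧̂_ _∨̂_ _⇒̂_ _⇔̂_ : T → T → T
(φ ∧̂ ψ) d = φ d ∧' ψ d
(φ ∨̂ ψ) d = φ d ∨' ψ d
(φ ⇒̂ ψ) d = φ d ⇒' ψ d
(φ ⇔̂ ψ) = (φ ⇒̂ ψ) ∧̂ (ψ ⇒̂ φ)

¬̂_ : T → T
¬̂ φ = φ ⇒̂ ⊥̂

-- binders: the bound variable gets the level d (current depth)
Ȧ Ė : (ℕ → T) → T
Ȧ f d = ∀' (f d (suc d))
Ė f d = ∃' (f d (suc d))

-- a formula (scheme parameter) with designated variable 0 (= x);
-- its other free variables suc n are parameters (free variable n
-- of the ambient axiom)
app1 : Fm → ℕ → T
app1 φ x d = rename σ φ
  where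
  σ : ℕ → ℕ
  σ zero    = d ∸ suc x
  σ (suc n) = n + d

-- a formula with designated variables 0 (first argument) and 1
-- (second argument); free variables suc (suc n) are parameters
app2 : Fm → ℕ → ℕ → T
app2 R u v d = rename σ R
  where
  σ : ℕ → ℕ
  σ zero          = d ∸ suc u
  σ (suc zero)    = d ∸ suc v
  σ (suc (suc n)) = n + d

cl : T → Fm
cl φ = φ 0


_⊆̂_ : ℕ → ℕ → T
a ⊆̂ b = Ȧ λ x → x ∈̂ a ⇒̂ x ∈̂ b

data Axiom : Fm → Set where
  eq-refl  : Axiom (cl (Ȧ (λ x → x ≐̂ x)))
  eq-eucl  : Axiom (cl (Ȧ λ x → Ȧ λ x' → Ȧ λ y →
                       x ≐̂ x' ∧̂ x ≐̂ y ⇒̂ x' ≐̂ y))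
  eq-memˡ  : Axiom (cl (Ȧ λ x → Ȧ λ x' → Ȧ λ y →
                       x ≐̂ x' ∧̂ x ∈̂ y ⇒̂ x' ∈̂ y))
  eq-memʳ  : Axiom (cl (Ȧ λ x → Ȧ λ y → Ȧ λ y' →
                       y ≐̂ y' ∧̂ x ∈̂ y ⇒̂ x ∈̂ y'))
  strong-ext : (R : Fm) → Axiom (cl (
    Ȧ λ a → Ȧ λ b →
      app2 R a b
      ∧̂ (Ȧ λ x → Ȧ λ x' → Ȧ λ y →
           x' ∈̂ x ∧̂ app2 R x y ⇒̂ Ė λ y' → y' ∈̂ y ∧̂ app2 R x' y')
      ∧̂ (Ȧ λ y → Ȧ λ y' → Ȧ λ x →
           y' ∈̂ y ∧̂ app2 R x y ⇒̂ Ė λ x' → x' ∈̂ x ∧̂ app2 R x' y')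
      ⇒̂ a ≐̂ b))
  pairing  : Axiom (cl (Ȧ λ a → Ȧ λ b → Ė λ c → Ȧ λ x →
                       x ∈̂ c ⇔̂ x ≐̂ a ∨̂ x ≐̂ b))
  union    : Axiom (cl (Ȧ λ a → Ė λ c → Ȧ λ x →
                       x ∈̂ c ⇔̂ Ė λ y → y ∈̂ a ∧̂ x ∈̂ y))
  powerset : Axiom (cl (Ȧ λ a → Ė λ c → Ȧ λ x →
                       x ∈̂ c ⇔̂ x ⊆̂ a))
  comprehension : (φ : Fm) → Axiom (cl (Ȧ λ a → Ė λ c → Ȧ λ x →
                       x ∈̂ c ⇔̂ x ∈̂ a ∧̂ app1 φ x))
  infinity : Axiom (cl (Ė λ w →
                       (Ė λ z → z ∈̂ w ∧̂ (Ȧ λ u → ¬̂ (u ∈̂ z)))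
                       ∧̂ (Ȧ λ y → y ∈̂ w ⇒̂ Ė λ z → z ∈̂ w ∧̂
                            (Ȧ λ u → u ∈̂ z ⇔̂ u ∈̂ y ∨̂ u ≐̂ y))))
  transitive-closure : Axiom (cl (Ȧ λ a → Ė λ e →
                       a ⊆̂ e ∧̂ (Ȧ λ x → Ȧ λ y → x ∈̂ y ∧̂ y ∈̂ e ⇒̂ x ∈̂ e)))

infix 2 _⊢_

data _⊢_ (Γ : List Fm) : Fm → Set where
  hyp  : ∀ {φ} → φ ∈ Γ → Γ ⊢ φ
  ax   : ∀ {φ} → Axiom φ → Γ ⊢ φ
  ⊥E   : ∀ {φ} → Γ ⊢ ⊥' → Γ ⊢ φ
  ∧I   : ∀ {φ ψ} → Γ ⊢ φ → Γ ⊢ ψ → Γ ⊢ φ ∧' ψ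
  ∧E₁  : ∀ {φ ψ} → Γ ⊢ φ ∧' ψ → Γ ⊢ φ
  ∧E₂  : ∀ {φ ψ} → Γ ⊢ φ ∧' ψ → Γ ⊢ ψ
  ∨I₁  : ∀ {φ ψ} → Γ ⊢ φ → Γ ⊢ φ ∨' ψ
  ∨I₂  : ∀ {φ ψ} → Γ ⊢ ψ → Γ ⊢ φ ∨' ψ
  ∨E   : ∀ {φ ψ χ} → Γ ⊢ φ ∨' ψ → φ ∷ Γ ⊢ χ → ψ ∷ Γ ⊢ χ → Γ ⊢ χ
  ⇒I   : ∀ {φ ψ} → φ ∷ Γ ⊢ ψ → Γ ⊢ φ ⇒' ψ
  ⇒E   : ∀ {φ ψ} → Γ ⊢ φ ⇒' ψ → Γ ⊢ φ → Γ ⊢ ψ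
  ∀I   : ∀ {φ} → map wk Γ ⊢ φ → Γ ⊢ ∀' φ
  ∀E   : ∀ {φ} → Γ ⊢ ∀' φ → (y : ℕ) → Γ ⊢ φ [ y ]
  ∃I   : ∀ {φ} (y : ℕ) → Γ ⊢ φ [ y ] → Γ ⊢ ∃' φ
  ∃E   : ∀ {φ ψ} → Γ ⊢ ∃' φ → φ ∷ map wk Γ ⊢ wk ψ → Γ ⊢ ψ

Zst⊢ : Fm → Set
Zst⊢ φ = Data.List.[] ⊢ φ

IsSing : ℕ → ℕ → T
IsSing z u = Ȧ λ w → w ∈̂ z ⇔̂ w ≐̂ u

IsPair : ℕ → ℕ → ℕ → T
IsPair z u v = Ȧ λ w → w ∈̂ z ⇔̂ w ≐̂ u ∨̂ w ≐̂ v

IsOP : ℕ → ℕ → ℕ → T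
IsOP p u v = Ȧ λ z → z ∈̂ p ⇔̂ IsSing z u ∨̂ IsPair z u v

OPin : ℕ → ℕ → ℕ → T
OPin u v A = Ė λ p → p ∈̂ A ∧̂ IsOP p u v

Graph : ℕ → T
Graph A = Ȧ λ p → p ∈̂ A ⇒̂ Ė λ u → Ė λ v → IsOP p u v

Function : ℕ → T
Function ϕ = Graph ϕ ∧̂
  (Ȧ λ x → Ȧ λ y → Ȧ λ y' → OPin x y ϕ ∧̂ OPin x y' ϕ ⇒̂ y ≐̂ y')

InDom : ℕ → ℕ → T
InDom i ϕ = Ė λ y → OPin i y ϕ

InCod : ℕ → ℕ → T
InCod y ϕ = Ė λ i → OPin i y ϕ

InUU : ℕ → ℕ → T
InUU x A = Ė λ s → Ė λ t → s ∈̂ A ∧̂ t ∈̂ s ∧̂ x ∈̂ t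

InCar : ℕ → ℕ → T
InCar x A = InUU x A ∧̂ (Ė λ y → OPin x y A ∨̂ OPin y x A)

InApp : ℕ → ℕ → ℕ → T
InApp x ϕ i = Ė λ y → OPin i y ϕ ∧̂ x ∈̂ y

EqApp : ℕ → ℕ → ℕ → T
EqApp x ϕ j = OPin j x ϕ

Collapse : ℕ → ℕ → T
Collapse A ϕ =
  Graph A ∧̂ Function ϕ
  ∧̂ (Ȧ λ i → InDom i ϕ ⇔̂ InCar i A)
  ∧̂ (Ȧ λ i → InDom i ϕ ⇒̂ Ȧ λ x →
        InApp x ϕ i ⇔̂ Ė λ j → InDom j ϕ ∧̂ OPin j i A ∧̂ EqApp x ϕ j)

EqHat : ℕ → ℕ → ℕ → ℕ → T
EqHat x ϕ A a = Ȧ λ y → y ∈̂ x ⇔̂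
  InCod y ϕ ∧̂ (Ė λ j → OPin j a A ∧̂ OPin j y ϕ)

Reif : ℕ → ℕ → T
Reif g x = Ė λ A → Ė λ a → Ė λ ϕ →
  IsOP g A a ∧̂ Collapse A ϕ ∧̂ EqHat x ϕ A a

AllReifiable : Fm
AllReifiable = cl (Ȧ λ x → Ė λ g → Reif g x)

module Submission where

-- Let e be a transitive set containing x (the transitive closure of {x}),
-- A the membership relation on e, carved out of 𝒫𝒫e as a set of ordered
-- pairs, and ϕ the identity on the field of A. Since e is transitive, ϕ is
-- a collapse of A (the Mostowski collapse of a transitive set is the
-- identity), and ϕ̂_A(x) = {j | j ∈ x} = x; so Reif(⟨A, x⟩, x).
-- Strong Extensionality is used only through ordinary extensionality, which
-- makes singletons and unordered pairs unique and hence ordered pairs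
-- injective.

open import Defs
open import Data.Nat using (ℕ; zero; suc; _∸_; _<ᵇ_)
open import Data.Bool using () renaming (T to True)
open import Data.List using (List; []; _∷_; map; length; upTo)
open import Data.List.Membership.Propositional using (_∈_)
open import Data.List.Relation.Unary.Any using (here; there)
open import Data.List.Relation.Binary.Subset.Propositional using (_⊆_)
open import Data.List.Relation.Binary.Subset.Propositional.Properties using (map⁺; ∷⁺ʳ)
open import Relation.Binary.PropositionalEquality using (refl)

weaken : ∀ {Γ Δ φ} → Γ ⊆ Δ → Γ ⊢ φ → Δ ⊢ φ
weaken s (hyp p)     = hyp (s p)
weaken s (ax a)      = ax a
weaken s (⊥E d)      = ⊥E (weaken s d)
weaken s (∧I d e)    = ∧I (weaken s d) (weaken s e)
weaken s (∧E₁ d)     = ∧E₁ (weaken s d)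
weaken s (∧E₂ d)     = ∧E₂ (weaken s d)
weaken s (∨I₁ d)     = ∨I₁ (weaken s d)
weaken s (∨I₂ d)     = ∨I₂ (weaken s d)
weaken s (∨E d e f)  = ∨E (weaken s d) (weaken (∷⁺ʳ _ s) e) (weaken (∷⁺ʳ _ s) f)
weaken s (⇒I d)      = ⇒I (weaken (∷⁺ʳ _ s) d)
weaken s (⇒E d e)    = ⇒E (weaken s d) (weaken s e)
weaken s (∀I d)      = ∀I (weaken (map⁺ wk s) d)
weaken s (∀E d y)    = ∀E (weaken s d) y
weaken s (∃I y d)    = ∃I y (weaken s d)
weaken s (∃E d e)    = ∃E (weaken s d) (weaken (∷⁺ʳ _ (map⁺ wk s)) e)

closed : ∀ {Γ φ} → [] ⊢ φ → Γ ⊢ φ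
closed = weaken (λ ())

cut : ∀ {Γ φ ψ} → Γ ⊢ φ → φ ∷ Γ ⊢ ψ → Γ ⊢ ψ
cut d e = ⇒E (⇒I e) d

nth : List Fm → ℕ → Fm
nth []       _       = ⊥'
nth (φ ∷ Γ) zero    = φ
nth (φ ∷ Γ) (suc n) = nth Γ n

nth-∈ : ∀ Γ n → True (n <ᵇ length Γ) → nth Γ n ∈ Γ
nth-∈ (φ ∷ Γ) zero    _ = here refl
nth-∈ (φ ∷ Γ) (suc n) t = there (nth-∈ Γ n t)

-- the n-th open hypothesis, counted from the most recent one
#_ : ∀ {Γ} n → {t : True (n <ᵇ length Γ)} → Γ ⊢ nth Γ n
#_ {Γ} n {t} = hyp (nth-∈ Γ n t)

after : Fm → List ℕ → Fm
after (∀' φ) (a ∷ as) = after (φ [ a ]) as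
after φ      _        = φ

∀E* : ∀ {Γ φ} → Γ ⊢ φ → (as : List ℕ) → Γ ⊢ after φ as
∀E* {φ = ∀' φ}    d (a ∷ as) = ∀E* (∀E d a) as
∀E* {φ = ∀' φ}    d []       = d
∀E* {φ = _ ∈' _}  d _        = d
∀E* {φ = _ ≐' _}  d _        = d
∀E* {φ = ⊥'}      d _        = d
∀E* {φ = _ ∧' _}  d _        = d
∀E* {φ = _ ∨' _}  d _        = d
∀E* {φ = _ ⇒' _}  d _        = d
∀E* {φ = ∃' _}    d _        = d

infixl 5 _at_

_at_ : ∀ {Γ φ} → [] ⊢ φ → (as : List ℕ) → Γ ⊢ after φ as
L at as = ∀E* (closed L) as

_⇔'_ : Fm → Fm → Fm
φ ⇔' ψ = (φ ⇒' ψ) ∧' (ψ ⇒' φ)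

⇔E₁ : ∀ {Γ φ ψ} → Γ ⊢ φ ⇔' ψ → Γ ⊢ φ → Γ ⊢ ψ
⇔E₁ h = ⇒E (∧E₁ h)

⇔E₂ : ∀ {Γ φ ψ} → Γ ⊢ φ ⇔' ψ → Γ ⊢ ψ → Γ ⊢ φ
⇔E₂ h = ⇒E (∧E₂ h)

≐-refl : ∀ {Γ} a → Γ ⊢ a ≐' a
≐-refl a = ∀E (ax eq-refl) a

≐-sym : ∀ {Γ a b} → Γ ⊢ a ≐' b → Γ ⊢ b ≐' a
≐-sym {a = a} {b} h = ⇒E (∀E* (ax eq-eucl) (a ∷ b ∷ a ∷ [])) (∧I h (≐-refl a))

≐-trans : ∀ {Γ a b c} → Γ ⊢ a ≐' b → Γ ⊢ b ≐' c → Γ ⊢ a ≐' c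
≐-trans {a = a} {b} {c} h k = ⇒E (∀E* (ax eq-eucl) (b ∷ a ∷ c ∷ [])) (∧I (≐-sym h) k)

∈-respˡ-≐ : ∀ {Γ a b c} → Γ ⊢ a ≐' b → Γ ⊢ a ∈' c → Γ ⊢ b ∈' c
∈-respˡ-≐ {a = a} {b} {c} h k = ⇒E (∀E* (ax eq-memˡ) (a ∷ b ∷ c ∷ [])) (∧I h k)

∈-respʳ-≐ : ∀ {Γ a b c} → Γ ⊢ b ≐' c → Γ ⊢ a ∈' b → Γ ⊢ a ∈' c
∈-respʳ-≐ {a = a} {b} {c} h k = ⇒E (∀E* (ax eq-memʳ) (a ∷ b ∷ c ∷ [])) (∧I h k)

-- R(a, b) := ∀y (y ∈ a ⇔ y ∈ b), a strong-extensionality relation whose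
-- back-and-forth conditions are met with y' = x'.
SameElements : Fm
SameElements = ∀' ((0 ∈' 1) ⇔' (0 ∈' 2))

SameElements-refl : ∀ {Γ} a → Γ ⊢ ∀' ((0 ∈' suc a) ⇔' (0 ∈' suc a))
SameElements-refl a = ∀I (∧I (⇒I (# 0)) (⇒I (# 0)))

extensionality : [] ⊢ cl (Ȧ λ a → Ȧ λ b → (Ȧ λ y → y ∈̂ a ⇔̂ y ∈̂ b) ⇒̂ a ≐̂ b)
extensionality = ∀I (∀I (⇒I (⇒E (∀E* (ax (strong-ext SameElements)) (1 ∷ 0 ∷ []))
  (∧I (# 0) (∧I
    (∀I (∀I (∀I (⇒I (∃I 1 (∧I (⇔E₁ (∀E (∧E₂ (# 0)) 1) (∧E₁ (# 0))) (SameElements-refl 1)))))))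
    (∀I (∀I (∀I (⇒I (∃I 1 (∧I (⇔E₂ (∀E (∧E₂ (# 0)) 1) (∧E₁ (# 0))) (SameElements-refl 1))))))))))))

≐-ext : ∀ {Γ a b} → Γ ⊢ ∀' ((0 ∈' suc a) ⇔' (0 ∈' suc b)) → Γ ⊢ a ≐' b
≐-ext {a = a} {b} = ⇒E (extensionality at (a ∷ b ∷ []))

∃-IsSing : [] ⊢ cl (Ȧ λ u → Ė λ z → IsSing z u)
∃-IsSing = ∀I (∃E (∀E* (ax pairing) (0 ∷ 0 ∷ []))
  (∃I 0 (∀I (∧I (⇒I (∨E (⇔E₁ (∀E (# 1) 0) (# 0)) (# 0) (# 0)))
                (⇒I (⇔E₂ (∀E (# 1) 0) (∨I₁ (# 0))))))))

IsSing-unique : [] ⊢ cl (Ȧ λ z → Ȧ λ z' → Ȧ λ u → IsSing z u ∧̂ IsSing z' u ⇒̂ z ≐̂ z')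
IsSing-unique = ∀I (∀I (∀I (⇒I (≐-ext (∀I (∧I
  (⇒I (⇔E₂ (∀E (∧E₂ (# 1)) 0) (⇔E₁ (∀E (∧E₁ (# 1)) 0) (# 0))))
  (⇒I (⇔E₂ (∀E (∧E₁ (# 1)) 0) (⇔E₁ (∀E (∧E₂ (# 1)) 0) (# 0))))))))))

IsPair-unique : [] ⊢ cl (Ȧ λ z → Ȧ λ z' → Ȧ λ u → Ȧ λ w → IsPair z u w ∧̂ IsPair z' u w ⇒̂ z ≐̂ z')
IsPair-unique = ∀I (∀I (∀I (∀I (⇒I (≐-ext (∀I (∧I
  (⇒I (⇔E₂ (∀E (∧E₂ (# 1)) 0) (⇔E₁ (∀E (∧E₁ (# 1)) 0) (# 0))))
  (⇒I (⇔E₂ (∀E (∧E₁ (# 1)) 0) (⇔E₁ (∀E (∧E₂ (# 1)) 0) (# 0)))))))))))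

IsSing-respˡ-≐ : [] ⊢ cl (Ȧ λ z → Ȧ λ z' → Ȧ λ u → z ≐̂ z' ∧̂ IsSing z' u ⇒̂ IsSing z u)
IsSing-respˡ-≐ = ∀I (∀I (∀I (⇒I (∀I (∧I
  (⇒I (⇔E₁ (∀E (∧E₂ (# 1)) 0) (∈-respʳ-≐ (∧E₁ (# 1)) (# 0))))
  (⇒I (∈-respʳ-≐ (≐-sym (∧E₁ (# 1))) (⇔E₂ (∀E (∧E₂ (# 1)) 0) (# 0)))))))))

IsPair-respˡ-≐ : [] ⊢ cl (Ȧ λ z → Ȧ λ z' → Ȧ λ u → Ȧ λ w → z ≐̂ z' ∧̂ IsPair z' u w ⇒̂ IsPair z u w)
IsPair-respˡ-≐ = ∀I (∀I (∀I (∀I (⇒I (∀I (∧I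
  (⇒I (⇔E₁ (∀E (∧E₂ (# 1)) 0) (∈-respʳ-≐ (∧E₁ (# 1)) (# 0))))
  (⇒I (∈-respʳ-≐ (≐-sym (∧E₁ (# 1))) (⇔E₂ (∀E (∧E₂ (# 1)) 0) (# 0))))))))))

∃-IsOP : [] ⊢ cl (Ȧ λ u → Ȧ λ w → Ė λ p → IsOP p u w)
∃-IsOP = ∀I (∀I (∃E (∃-IsSing at (1 ∷ [])) (∃E (∀E* (ax pairing) (2 ∷ 1 ∷ [])) (∃E (∀E* (ax pairing) (1 ∷ 0 ∷ []))
  (∃I 0 (∀I (∧I
    (⇒I (∨E (⇔E₁ (∀E (# 1) 0) (# 0))
       (∨I₁ (⇒E (IsSing-respˡ-≐ at (0 ∷ 3 ∷ 5 ∷ [])) (∧I (# 0) (# 4))))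
       (∨I₂ (⇒E (IsPair-respˡ-≐ at (0 ∷ 2 ∷ 5 ∷ 4 ∷ [])) (∧I (# 0) (# 3))))))
    (⇒I (∨E (# 0)
       (⇔E₂ (∀E (# 2) 0) (∨I₁ (⇒E (IsSing-unique at (0 ∷ 3 ∷ 5 ∷ [])) (∧I (# 0) (# 4)))))
       (⇔E₂ (∀E (# 2) 0) (∨I₂ (⇒E (IsPair-unique at (0 ∷ 2 ∷ 5 ∷ 4 ∷ [])) (∧I (# 0) (# 3))))))))))))))

IsOP-injective₁ : [] ⊢ cl (Ȧ λ p → Ȧ λ a → Ȧ λ b → Ȧ λ c → Ȧ λ d →
                 IsOP p a b ∧̂ IsOP p c d ⇒̂ a ≐̂ c)
IsOP-injective₁ = ∀I (∀I (∀I (∀I (∀I (⇒I (∃E (∃-IsSing at (3 ∷ []))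
  (∨E (⇔E₁ (∀E (∧E₂ (# 1)) 0) (⇔E₂ (∀E (∧E₁ (# 1)) 0) (∨I₁ (# 0))))
    (⇔E₁ (∀E (# 0) 4) (⇔E₂ (∀E (# 1) 4) (≐-refl 4)))
    (∨E (⇔E₁ (∀E (# 0) 4) (⇔E₂ (∀E (# 1) 4) (≐-refl 4)))
      (# 0)
      (≐-sym (⇔E₁ (∀E (# 2) 2) (⇔E₂ (∀E (# 1) 2) (∨I₁ (≐-refl 2)))))))))))))

-- With a ≐ c known, compare {a, b} ∈ ⟨c, d⟩ with {c} and {c, d}, and
-- {c, d} ∈ ⟨a, b⟩ with {a} and {a, b}.
IsOP-injective₂ : [] ⊢ cl (Ȧ λ p → Ȧ λ a → Ȧ λ b → Ȧ λ c → Ȧ λ d →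
                 IsOP p a b ∧̂ IsOP p c d ⇒̂ b ≐̂ d)
IsOP-injective₂ = ∀I (∀I (∀I (∀I (∀I (⇒I
  (cut (⇒E (IsOP-injective₁ at (4 ∷ 3 ∷ 2 ∷ 1 ∷ 0 ∷ [])) (# 0))
  (∃E (∀E* (ax pairing) (3 ∷ 2 ∷ []))
  (∨E (⇔E₁ (∀E (∧E₂ (# 2)) 0) (⇔E₂ (∀E (∧E₁ (# 2)) 0) (∨I₂ (# 0))))
    (cut (⇔E₁ (∀E (# 0) 3) (⇔E₂ (∀E (# 1) 3) (∨I₂ (≐-refl 3))))
      (∃E (∀E* (ax pairing) (2 ∷ 1 ∷ []))
        (∨E (⇔E₁ (∀E (∧E₁ (# 5)) 0) (⇔E₂ (∀E (∧E₂ (# 5)) 0) (∨I₂ (# 0))))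
          (≐-trans (≐-trans (# 2) (≐-sym (# 5))) (≐-sym (⇔E₁ (∀E (# 0) 2) (⇔E₂ (∀E (# 1) 2) (∨I₂ (≐-refl 2))))))
          (∨E (⇔E₁ (∀E (# 0) 2) (⇔E₂ (∀E (# 1) 2) (∨I₂ (≐-refl 2))))
            (≐-trans (≐-trans (# 3) (≐-sym (# 6))) (≐-sym (# 0)))
            (≐-sym (# 0))))))
    (∨E (⇔E₁ (∀E (# 0) 3) (⇔E₂ (∀E (# 1) 3) (∨I₂ (≐-refl 3))))
      (∨E (⇔E₁ (∀E (# 2) 1) (⇔E₂ (∀E (# 1) 1) (∨I₂ (≐-refl 1))))
        (≐-trans (# 1) (≐-trans (≐-sym (# 4)) (≐-sym (# 0))))
        (≐-sym (# 0)))
      (# 0))))))))))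

IsSing-respʳ-≐ : [] ⊢ cl (Ȧ λ z → Ȧ λ u → Ȧ λ u' → IsSing z u ∧̂ u ≐̂ u' ⇒̂ IsSing z u')
IsSing-respʳ-≐ = ∀I (∀I (∀I (⇒I (∀I (∧I
  (⇒I (≐-trans (⇔E₁ (∀E (∧E₁ (# 1)) 0) (# 0)) (∧E₂ (# 1))))
  (⇒I (⇔E₂ (∀E (∧E₁ (# 1)) 0) (≐-trans (# 0) (≐-sym (∧E₂ (# 1)))))))))))

IsPair-respʳ-≐ : [] ⊢ cl (Ȧ λ z → Ȧ λ u → Ȧ λ w → Ȧ λ u' → Ȧ λ w' →
                    IsPair z u w ∧̂ u ≐̂ u' ∧̂ w ≐̂ w' ⇒̂ IsPair z u' w')
IsPair-respʳ-≐ = ∀I (∀I (∀I (∀I (∀I (⇒I (∀I (∧I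
  (⇒I (∨E (⇔E₁ (∀E (∧E₁ (# 1)) 0) (# 0))
          (∨I₁ (≐-trans (# 0) (∧E₁ (∧E₂ (# 2)))))
          (∨I₂ (≐-trans (# 0) (∧E₂ (∧E₂ (# 2)))))))
  (⇒I (⇔E₂ (∀E (∧E₁ (# 1)) 0) (∨E (# 0)
          (∨I₁ (≐-trans (# 0) (≐-sym (∧E₁ (∧E₂ (# 2))))))
          (∨I₂ (≐-trans (# 0) (≐-sym (∧E₂ (∧E₂ (# 2))))))))))))))))

IsOP-respʳ-≐ : [] ⊢ cl (Ȧ λ p → Ȧ λ u → Ȧ λ w → Ȧ λ u' → Ȧ λ w' →
                  IsOP p u w ∧̂ u ≐̂ u' ∧̂ w ≐̂ w' ⇒̂ IsOP p u' w')
IsOP-respʳ-≐ = ∀I (∀I (∀I (∀I (∀I (⇒I (∀I (∧I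
  (⇒I (∨E (⇔E₁ (∀E (∧E₁ (# 1)) 0) (# 0))
     (∨I₁ (⇒E (IsSing-respʳ-≐ at (0 ∷ 4 ∷ 2 ∷ [])) (∧I (# 0) (∧E₁ (∧E₂ (# 2))))))
     (∨I₂ (⇒E (IsPair-respʳ-≐ at (0 ∷ 4 ∷ 3 ∷ 2 ∷ 1 ∷ [])) (∧I (# 0) (∧E₂ (# 2)))))))
  (⇒I (⇔E₂ (∀E (∧E₁ (# 1)) 0) (∨E (# 0)
     (∨I₁ (⇒E (IsSing-respʳ-≐ at (0 ∷ 2 ∷ 4 ∷ [])) (∧I (# 0) (≐-sym (∧E₁ (∧E₂ (# 2)))))))
     (∨I₂ (⇒E (IsPair-respʳ-≐ at (0 ∷ 2 ∷ 1 ∷ 4 ∷ 3 ∷ []))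
        (∧I (# 0) (∧I (≐-sym (∧E₁ (∧E₂ (# 2)))) (≐-sym (∧E₂ (∧E₂ (# 2))))))))))))))))))

IsOP-∈∈ : [] ⊢ cl (Ȧ λ p → Ȧ λ u → Ȧ λ w → IsOP p u w ⇒̂ Ė λ t → t ∈̂ p ∧̂ u ∈̂ t ∧̂ w ∈̂ t)
IsOP-∈∈ = ∀I (∀I (∀I (⇒I (∃E (∀E* (ax pairing) (1 ∷ 0 ∷ []))
  (∃I 0 (∧I (⇔E₂ (∀E (# 1) 0) (∨I₂ (# 0)))
    (∧I (⇔E₂ (∀E (# 0) 2) (∨I₁ (≐-refl 2))) (⇔E₂ (∀E (# 0) 1) (∨I₂ (≐-refl 1))))))))))

InCar-resp-≐ : [] ⊢ cl (Ȧ λ y → Ȧ λ y' → Ȧ λ A → InCar y A ∧̂ y ≐̂ y' ⇒̂ InCar y' A)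
InCar-resp-≐ = ∀I (∀I (∀I (⇒I (∧I
  (∃E (∧E₁ (∧E₁ (# 0))) (∃E (# 0)
    (∃I 1 (∃I 0 (∧I (∧E₁ (# 0)) (∧I (∧E₁ (∧E₂ (# 0))) (∈-respˡ-≐ (∧E₂ (# 2)) (∧E₂ (∧E₂ (# 0))))))))))
  (∃E (∧E₂ (∧E₁ (# 0))) (∃I 0 (∨E (# 0)
    (∨I₁ (∃E (# 0) (∃I 0 (∧I (∧E₁ (# 0))
       (⇒E (IsOP-respʳ-≐ at (0 ∷ 4 ∷ 1 ∷ 3 ∷ 1 ∷ [])) (∧I (∧E₂ (# 0)) (∧I (∧E₂ (# 3)) (≐-refl 1))))))))
    (∨I₂ (∃E (# 0) (∃I 0 (∧I (∧E₁ (# 0))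
       (⇒E (IsOP-respʳ-≐ at (0 ∷ 1 ∷ 4 ∷ 1 ∷ 3 ∷ [])) (∧I (∧E₂ (# 0)) (∧I (≐-refl 1) (∧E₂ (# 3))))))))))))))))

Transitive : ℕ → T
Transitive e = Ȧ λ a → Ȧ λ b → a ∈̂ b ∧̂ b ∈̂ e ⇒̂ a ∈̂ e

IsPowerset : ℕ → ℕ → T
IsPowerset P e = Ȧ λ z → z ∈̂ P ⇔̂ z ⊆̂ e

MembershipPair : ℕ → ℕ → T
MembershipPair e p = Ė λ j → Ė λ i → IsOP p j i ∧̂ j ∈̂ i ∧̂ i ∈̂ e

DiagonalPair : ℕ → ℕ → T
DiagonalPair A p = Ė λ w → IsOP p w w ∧̂ InCar w A

-- B = 𝒫𝒫e contains ⟨u, w⟩ for all u, w ∈ e, so A and ϕ can be cut out of it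
-- by comprehension.
Witnesses : ℕ → ℕ → ℕ → ℕ → ℕ → ℕ → ℕ → T
Witnesses x s e P B A ϕ =
  IsPair s x x
  ∧̂ (s ⊆̂ e ∧̂ Transitive e)
  ∧̂ IsPowerset P e
  ∧̂ IsPowerset B P
  ∧̂ (Ȧ λ p → p ∈̂ A ⇔̂ p ∈̂ B ∧̂ MembershipPair e p)
  ∧̂ (Ȧ λ p → p ∈̂ ϕ ⇔̂ p ∈̂ B ∧̂ DiagonalPair A p)

UnderWitnesses : (ℕ → ℕ → ℕ → ℕ → ℕ → ℕ → ℕ → T) → Fm
UnderWitnesses S = cl (Ȧ λ x → Ȧ λ s → Ȧ λ e → Ȧ λ P → Ȧ λ B → Ȧ λ A → Ȧ λ ϕ →
  Witnesses x s e P B A ϕ ⇒̂ S x s e P B A ϕ)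

-- the variables x, s, e, P, B, A, ϕ (levels 0–6) when D variables are in scope
witnesses : ℕ → List ℕ
witnesses D = map (λ l → D ∸ suc l) (upTo 7)

∀I⁷ : ∀ {φ} → [] ⊢ φ → [] ⊢ ∀' (∀' (∀' (∀' (∀' (∀' (∀' φ))))))
∀I⁷ d = ∀I (∀I (∀I (∀I (∀I (∀I (∀I d))))))

s-spec : ∀ {Γ a r} → Γ ⊢ a ∧' r → Γ ⊢ a
s-spec h = ∧E₁ h

e-spec : ∀ {Γ a b r} → Γ ⊢ a ∧' (b ∧' r) → Γ ⊢ b
e-spec h = ∧E₁ (∧E₂ h)

P-spec : ∀ {Γ a b c r} → Γ ⊢ a ∧' (b ∧' (c ∧' r)) → Γ ⊢ c
P-spec h = ∧E₁ (∧E₂ (∧E₂ h))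

B-spec : ∀ {Γ a b c d r} → Γ ⊢ a ∧' (b ∧' (c ∧' (d ∧' r))) → Γ ⊢ d
B-spec h = ∧E₁ (∧E₂ (∧E₂ (∧E₂ h)))

A-spec : ∀ {Γ a b c d e r} → Γ ⊢ a ∧' (b ∧' (c ∧' (d ∧' (e ∧' r)))) → Γ ⊢ e
A-spec h = ∧E₁ (∧E₂ (∧E₂ (∧E₂ (∧E₂ h))))

ϕ-spec : ∀ {Γ a b c d e f} → Γ ⊢ a ∧' (b ∧' (c ∧' (d ∧' (e ∧' f)))) → Γ ⊢ f
ϕ-spec h = ∧E₂ (∧E₂ (∧E₂ (∧E₂ (∧E₂ h))))

pair-∈B : [] ⊢ UnderWitnesses (λ x s e P B A ϕ → Ȧ λ u → Ȧ λ w → u ∈̂ e ∧̂ w ∈̂ e ⇒̂ Ė λ p → IsOP p u w ∧̂ p ∈̂ B)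
pair-∈B = ∀I⁷ (⇒I (∀I (∀I (⇒I (∃E (∃-IsOP at (1 ∷ 0 ∷ []))
  (∃I 0 (∧I (# 0) (⇔E₂ (∀E (B-spec (# 2)) 0) (∀I (⇒I (⇔E₂ (∀E (P-spec (# 3)) 0) (∀I (⇒I
    (∨E (⇔E₁ (∀E (# 2) 1) (# 1))
      (∈-respˡ-≐ (≐-sym (⇔E₁ (∀E (# 0) 0) (# 1))) (∧E₁ (# 4)))
      (∨E (⇔E₁ (∀E (# 0) 0) (# 1))
        (∈-respˡ-≐ (≐-sym (# 0)) (∧E₁ (# 5)))
        (∈-respˡ-≐ (≐-sym (# 0)) (∧E₂ (# 5))))))))))))))))))

∈⇒edge : [] ⊢ UnderWitnesses (λ x s e P B A ϕ → Ȧ λ j → Ȧ λ i → j ∈̂ i ∧̂ i ∈̂ e ⇒̂ OPin j i A)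
∈⇒edge = ∀I⁷ (⇒I (∀I (∀I (⇒I
  (∃E (⇒E (∀E (∀E (⇒E (pair-∈B at witnesses 9) (# 1)) 1) 0)
           (∧I (⇒E (∀E (∀E (∧E₂ (e-spec (# 1))) 1) 0) (# 0)) (∧E₂ (# 0))))
    (∃I 0 (∧I (⇔E₂ (∀E (A-spec (# 2)) 0) (∧I (∧E₂ (# 0)) (∃I 2 (∃I 1 (∧I (∧E₁ (# 0)) (# 1))))))
              (∧E₁ (# 0)))))))))

edge⇒∈ : [] ⊢ UnderWitnesses (λ x s e P B A ϕ → Ȧ λ j → Ȧ λ i → OPin j i A ⇒̂ j ∈̂ i ∧̂ i ∈̂ e)
edge⇒∈ = ∀I⁷ (⇒I (∀I (∀I (⇒I
  (∃E (# 0) (∃E (∧E₂ (⇔E₁ (∀E (A-spec (# 2)) 0) (∧E₁ (# 0)))) (∃E (# 0)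
    (∧I (∈-respʳ-≐ (≐-sym (⇒E (IsOP-injective₂ at (2 ∷ 4 ∷ 3 ∷ 1 ∷ 0 ∷ [])) (∧I (∧E₂ (# 2)) (∧E₁ (# 0)))))
             (∈-respˡ-≐ (≐-sym (⇒E (IsOP-injective₁ at (2 ∷ 4 ∷ 3 ∷ 1 ∷ 0 ∷ [])) (∧I (∧E₂ (# 2)) (∧E₁ (# 0)))))
                  (∧E₁ (∧E₂ (# 0)))))
        (∈-respˡ-≐ (≐-sym (⇒E (IsOP-injective₂ at (2 ∷ 4 ∷ 3 ∷ 1 ∷ 0 ∷ [])) (∧I (∧E₂ (# 2)) (∧E₁ (# 0)))))
             (∧E₂ (∧E₂ (# 0))))))))))))

field⊆e : [] ⊢ UnderWitnesses (λ x s e P B A ϕ → Ȧ λ y → InUU y A ⇒̂ y ∈̂ e)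
field⊆e = ∀I⁷ (⇒I (∀I (⇒I (∃E (# 0) (∃E (# 0)
  (⇒E (∀E (⇔E₁ (∀E (P-spec (# 3)) 0)
             (⇒E (∀E (⇔E₁ (∀E (B-spec (# 3)) 1) (∧E₁ (⇔E₁ (∀E (A-spec (# 3)) 1) (∧E₁ (# 0))))) 0)
                 (∧E₁ (∧E₂ (# 0))))) 2)
      (∧E₂ (∧E₂ (# 0)))))))))

∈⇒InCar : [] ⊢ UnderWitnesses (λ x s e P B A ϕ → Ȧ λ j → Ȧ λ i → j ∈̂ i ∧̂ i ∈̂ e ⇒̂ InCar j A ∧̂ InCar i A)
∈⇒InCar = ∀I⁷ (⇒I (∀I (∀I (⇒I (cut (⇒E (∀E (∀E (⇒E (∈⇒edge at witnesses 9) (# 1)) 1) 0) (# 0))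
  (∃E (# 0) (∃E (⇒E (IsOP-∈∈ at (0 ∷ 2 ∷ 1 ∷ [])) (∧E₂ (# 0)))
    (∧I (∧I (∃I 1 (∃I 0 (∧I (∧E₁ (# 1)) (∧I (∧E₁ (# 0)) (∧E₁ (∧E₂ (# 0)))))))
            (∃I 2 (∨I₁ (# 2))))
        (∧I (∃I 1 (∃I 0 (∧I (∧E₁ (# 1)) (∧I (∧E₁ (# 0)) (∧E₂ (∧E₂ (# 0)))))))
            (∃I 3 (∨I₂ (# 2))))))))))))

ϕ-refl : [] ⊢ UnderWitnesses (λ x s e P B A ϕ → Ȧ λ i → InCar i A ⇒̂ OPin i i ϕ)
ϕ-refl = ∀I⁷ (⇒I (∀I (⇒I
  (∃E (⇒E (∀E (∀E (⇒E (pair-∈B at witnesses 8) (# 1)) 0) 0)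
         (∧I (⇒E (∀E (⇒E (field⊆e at witnesses 8) (# 1)) 0) (∧E₁ (# 0)))
             (⇒E (∀E (⇒E (field⊆e at witnesses 8) (# 1)) 0) (∧E₁ (# 0)))))
    (∃I 0 (∧I (⇔E₂ (∀E (ϕ-spec (# 2)) 0) (∧I (∧E₂ (# 0)) (∃I 1 (∧I (∧E₁ (# 0)) (# 1)))))
              (∧E₁ (# 0))))))))

ϕ-diagonal : [] ⊢ UnderWitnesses (λ x s e P B A ϕ → Ȧ λ i → Ȧ λ y → OPin i y ϕ ⇒̂ i ≐̂ y ∧̂ InCar i A)
ϕ-diagonal = ∀I⁷ (⇒I (∀I (∀I (⇒I
  (∃E (# 0) (∃E (∧E₂ (⇔E₁ (∀E (ϕ-spec (# 2)) 0) (∧E₁ (# 0))))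
    (∧I (≐-trans (⇒E (IsOP-injective₁ at (1 ∷ 3 ∷ 2 ∷ 0 ∷ 0 ∷ [])) (∧I (∧E₂ (# 1)) (∧E₁ (# 0))))
            (≐-sym (⇒E (IsOP-injective₂ at (1 ∷ 3 ∷ 2 ∷ 0 ∷ 0 ∷ [])) (∧I (∧E₂ (# 1)) (∧E₁ (# 0))))))
        (⇒E (InCar-resp-≐ at (0 ∷ 3 ∷ 5 ∷ []))
            (∧I (∧E₂ (# 0)) (≐-sym (⇒E (IsOP-injective₁ at (1 ∷ 3 ∷ 2 ∷ 0 ∷ 0 ∷ [])) (∧I (∧E₂ (# 1)) (∧E₁ (# 0))))))))))))))

A-graph : [] ⊢ UnderWitnesses (λ x s e P B A ϕ → Graph A)
A-graph = ∀I⁷ (⇒I (∀I (⇒I (∃E (∧E₂ (⇔E₁ (∀E (A-spec (# 1)) 0) (# 0))) (∃E (# 0) (∃I 1 (∃I 0 (∧E₁ (# 0)))))))))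

ϕ-function : [] ⊢ UnderWitnesses (λ x s e P B A ϕ → Function ϕ)
ϕ-function = ∀I⁷ (⇒I (∧I
  (∀I (⇒I (∃E (∧E₂ (⇔E₁ (∀E (ϕ-spec (# 1)) 0) (# 0))) (∃I 0 (∃I 0 (∧E₁ (# 0)))))))
  (∀I (∀I (∀I (⇒I (≐-trans (≐-sym (∧E₁ (⇒E (∀E (∀E (⇒E (ϕ-diagonal at witnesses 10) (# 1)) 2) 1) (∧E₁ (# 0)))))
                      (∧E₁ (⇒E (∀E (∀E (⇒E (ϕ-diagonal at witnesses 10) (# 1)) 2) 0) (∧E₂ (# 0)))))))))))

Dom⇔Car : [] ⊢ UnderWitnesses (λ x s e P B A ϕ → Ȧ λ i → InDom i ϕ ⇔̂ InCar i A)
Dom⇔Car = ∀I⁷ (⇒I (∀I (∧I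
  (⇒I (∃E (# 0) (∧E₂ (⇒E (∀E (∀E (⇒E (ϕ-diagonal at witnesses 9) (# 2)) 1) 0) (# 0)))))
  (⇒I (∃I 0 (⇒E (∀E (⇒E (ϕ-refl at witnesses 8) (# 1)) 0) (# 0)))))))

-- ϕ(i) = i, so x ∈ ϕ(i) iff x ∈ i, and then j := x is the required A-predecessor.
ϕ-collapses : [] ⊢ UnderWitnesses (λ x s e P B A ϕ → Ȧ λ i → InDom i ϕ ⇒̂ Ȧ λ x →
        InApp x ϕ i ⇔̂ Ė λ j → InDom j ϕ ∧̂ OPin j i A ∧̂ EqApp x ϕ j)
ϕ-collapses = ∀I⁷ (⇒I (∀I (⇒I (∃E (# 0) (cut (∧E₂ (⇒E (∀E (∀E (⇒E (ϕ-diagonal at witnesses 9) (# 2)) 1) 0) (# 0)))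
  (∀I (∧I
    (⇒I (∃E (# 0)
      (cut (∧I (∈-respʳ-≐ (≐-sym (∧E₁ (⇒E (∀E (∀E (⇒E (ϕ-diagonal at witnesses 11) (# 5)) 3) 0) (∧E₁ (# 0))))) (∧E₂ (# 0)))
               (⇒E (∀E (⇒E (field⊆e at witnesses 11) (# 5)) 3) (∧E₁ (# 2))))
        (∃I 1 (∧I (∃I 1 (⇒E (∀E (⇒E (ϕ-refl at witnesses 11) (# 6)) 1)
                          (∧E₁ (⇒E (∀E (∀E (⇒E (∈⇒InCar at witnesses 11) (# 6)) 1) 3) (# 0)))))
                  (∧I (⇒E (∀E (∀E (⇒E (∈⇒edge at witnesses 11) (# 6)) 1) 3) (# 0))
                      (⇒E (∀E (⇒E (ϕ-refl at witnesses 11) (# 6)) 1)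
                          (∧E₁ (⇒E (∀E (∀E (⇒E (∈⇒InCar at witnesses 11) (# 6)) 1) 3) (# 0))))))))))
    (⇒I (∃E (# 0) (∃I 3 (∧I (⇒E (∀E (⇒E (ϕ-refl at witnesses 11) (# 5)) 3) (# 2))
      (∈-respˡ-≐ (∧E₁ (⇒E (∀E (∀E (⇒E (ϕ-diagonal at witnesses 11) (# 5)) 0) 1) (∧E₂ (∧E₂ (# 0)))))
           (∧E₁ (⇒E (∀E (∀E (⇒E (edge⇒∈ at witnesses 11) (# 5)) 0) 3) (∧E₁ (∧E₂ (# 0)))))))))))))))))

ϕ̂x≐x : [] ⊢ UnderWitnesses (λ x s e P B A ϕ → EqHat x ϕ A x)
ϕ̂x≐x = ∀I⁷ (⇒I (∀I (cut (⇒E (∀E (∧E₁ (e-spec (# 0))) 7) (⇔E₂ (∀E (s-spec (# 0)) 7) (∨I₁ (≐-refl 7))))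
  (∧I
    (⇒I (∧I (∃I 0 (⇒E (∀E (⇒E (ϕ-refl at witnesses 8) (# 2)) 0)
                 (∧E₁ (⇒E (∀E (∀E (⇒E (∈⇒InCar at witnesses 8) (# 2)) 0) 7) (∧I (# 0) (# 1))))))
            (∃I 0 (∧I (⇒E (∀E (∀E (⇒E (∈⇒edge at witnesses 8) (# 2)) 0) 7) (∧I (# 0) (# 1)))
                      (⇒E (∀E (⇒E (ϕ-refl at witnesses 8) (# 2)) 0)
                          (∧E₁ (⇒E (∀E (∀E (⇒E (∈⇒InCar at witnesses 8) (# 2)) 0) 7) (∧I (# 0) (# 1)))))))))
    (⇒I (∃E (∧E₂ (# 0))
      (∈-respˡ-≐ (∧E₁ (⇒E (∀E (∀E (⇒E (ϕ-diagonal at witnesses 9) (# 3)) 0) 1) (∧E₂ (# 0))))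
           (∧E₁ (⇒E (∀E (∀E (⇒E (edge⇒∈ at witnesses 9) (# 3)) 0) 8) (∧E₁ (# 0)))))))))))

reification : [] ⊢ UnderWitnesses (λ x s e P B A ϕ → Collapse A ϕ ∧̂ EqHat x ϕ A x)
reification = ∀I⁷ (⇒I (∧I
  (∧I (⇒E (A-graph at witnesses 7) (# 0))
  (∧I (⇒E (ϕ-function at witnesses 7) (# 0))
  (∧I (⇒E (Dom⇔Car at witnesses 7) (# 0))
      (⇒E (ϕ-collapses at witnesses 7) (# 0)))))
  (⇒E (ϕ̂x≐x at witnesses 7) (# 0))))

-- Comprehension formulas see the ambient variables as parameters: at depth
-- 4, levels 0, 1, 2 are e, P, B and level 3 is the comprehended variable;
-- at depth 2, level 0 is A.
A-comprehension : Fm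
A-comprehension = MembershipPair 0 3 4

ϕ-comprehension : Fm
ϕ-comprehension = DiagonalPair 0 1 2

proposition7 : Zst⊢ AllReifiable
proposition7 = ∀I
  (∃E (∀E* (ax pairing) (0 ∷ 0 ∷ []))
  (∃E (∀E (ax transitive-closure) 0)
  (∃E (∀E (ax powerset) 0)
  (∃E (∀E (ax powerset) 0)
  (∃E (∀E (ax (comprehension A-comprehension)) 0)
  (∃E (∀E (ax (comprehension ϕ-comprehension)) 1)
  (cut (⇒E (reification at (6 ∷ 5 ∷ 4 ∷ 3 ∷ 2 ∷ 1 ∷ 0 ∷ []))
           (∧I (# 5) (∧I (# 4) (∧I (# 3) (∧I (# 2) (∧I (# 1) (# 0)))))))
  (∃E (∃-IsOP at (1 ∷ 6 ∷ []))  -- g := ⟨A, x⟩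
      (∃I 0 (∃I 2 (∃I 7 (∃I 1 (∧I (# 0) (# 1))))))))))))))
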